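{- Let $K$ be a field of characteristic zero and $Q\colon K[x]\to K[x]$ a linear operator that has a DX-expansion, i.e. $Q=\sum_{k=0}^\infty f_k(D)X^k$ with $f_k\in K[[t]]$ and the sum converging in the discrete topology. Write $Qx^n=\sum_k c_{nk}x^k$ and $q_t(n)=c_{n,n+t}$ for integers $t$ and $n\ge0$ (with $c_{nk}=0$ for $k<0$). Then there is $T$ such that $q_t$ is identically zero for all $t>T$.
   Context: $D$ is differentiation and $X$ multiplication by $x$; $f(D)=\sum_jc_jD^j$ for $f=\sum_jc_jt^j$. Convergence in the discrete topology means that for every polynomial $p$ only finitely many terms $f_k(D)X^kp$ are nonzero. -}

module Defs where

open import Level using (Level; _⊔_)
open import Data.Nat using (ℕ; zero; suc; _≤_)
import Data.Nat as ℕ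
open import Data.List using (List; []; _∷_; [_]; _++_; map; replicate; length)
open import Data.Product using (Σ; ∃; ∃-syntax; _×_; _,_)
open import Relation.Nullary using (¬_)
open import Algebra.Bundles using (CommutativeRing)
import Algebra.Definitions.RawMonoid as RawMonoidDefs

IsField : ∀ {c ℓ} → CommutativeRing c ℓ → Set (c ⊔ ℓ)
IsField K = ¬ (0# ≈ 1#) × (∀ a → ¬ (a ≈ 0#) → ∃[ b ] (a * b ≈ 1#))
  where open CommutativeRing K

CharZero : ∀ {c ℓ} → CommutativeRing c ℓ → Set ℓ
CharZero K = ∀ n → ¬ (suc n ·ℕ 1# ≈ 0#)
  where
  open CommutativeRing K
  open RawMonoidDefs +-rawMonoid renaming (_×_ to _·ℕ_)

-- Polynomials over K as coefficient lists (constant term first), formal power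
-- series K[[t]] as coefficient sequences, and the operators D and X.
module Poly {c ℓ} (K : CommutativeRing c ℓ) where
  open CommutativeRing K
  open RawMonoidDefs +-rawMonoid renaming (_×_ to _·ℕ_)

  Pol : Set c
  Pol = List Carrier

  PowerSeries : Set c
  PowerSeries = ℕ → Carrier

  coeff : Pol → ℕ → Carrier
  coeff []      _       = 0#
  coeff (a ∷ p) zero    = a
  coeff (a ∷ p) (suc i) = coeff p i

  _≈P_ : Pol → Pol → Set ℓ
  p ≈P q = ∀ i → coeff p i ≈ coeff q i

  _+P_ : Pol → Pol → Pol
  []      +P q       = q
  (a ∷ p) +P []      = a ∷ p
  (a ∷ p) +P (b ∷ q) = (a + b) ∷ (p +P q)

  scale : Carrier → Pol → Pol
  scale a p = map (a *_) p

  zeroP : Pol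
  zeroP = []

  sumP : ℕ → (ℕ → Pol) → Pol
  sumP zero    g = zeroP
  sumP (suc N) g = sumP N g +P g N

  Xop : Pol → Pol
  Xop p = 0# ∷ p

  Xpow : ℕ → Pol → Pol
  Xpow zero    p = p
  Xpow (suc k) p = Xop (Xpow k p)

  derivAux : ℕ → Pol → Pol
  derivAux i []       = []
  derivAux i (b ∷ bs) = ((suc i ·ℕ 1#) * b) ∷ derivAux (suc i) bs

  Dop : Pol → Pol
  Dop []      = []
  Dop (_ ∷ p) = derivAux 0 p

  Dpow : ℕ → Pol → Pol
  Dpow zero    p = p
  Dpow (suc j) p = Dop (Dpow j p)

  -- f(D) p = Σ_j f_j D^j p ; the terms with j ≥ length p vanish, so the
  -- sum is taken over j < length p.
  applyD : PowerSeries → Pol → Pol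
  applyD f p = sumP (length p) (λ j → scale (f j) (Dpow j p))

  monomial : ℕ → Pol
  monomial n = replicate n 0# ++ [ 1# ]

  term : (ℕ → PowerSeries) → ℕ → Pol → Pol
  term f k p = applyD (f k) (Xpow k p)

  -- convergence in the discrete topology: for every polynomial p only
  -- finitely many terms f_k(D) X^k p are nonzero (all vanish beyond some N)
  Converges : (ℕ → PowerSeries) → Set (c ⊔ ℓ)
  Converges f = ∀ p → ∃[ N ] (∀ k → N ≤ k → term f k p ≈P zeroP)

  HasDXExpansion : (ℕ → PowerSeries) → (Pol → Pol) → Set (c ⊔ ℓ)
  HasDXExpansion f Q =
    Converges f ×
    (∀ p N → (∀ k → N ≤ k → term f k p ≈P zeroP) →
       Q p ≈P sumP N (λ k → term f k p))

  IsLinear : (Pol → Pol) → Set (c ⊔ ℓ)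
  IsLinear Q = (∀ p q → Q (p +P q) ≈P (Q p +P Q q)) ×
               (∀ a p → Q (scale a p) ≈P scale a (Q p))

  cQ : (Pol → Pol) → ℕ → ℕ → Carrier
  cQ Q n k = coeff (Q (monomial n)) k

  qQ : (Pol → Pol) → ℕ → ℕ → Carrier
  qQ Q t n = cQ Q n (n ℕ.+ t)

-- Feeding 1 = x^0 to the expansion, f_k(D) X^k 1 = Σ_{j ≤ k} f_{kj} (k!/(k-j)!) x^(k-j), and discrete
-- convergence makes these vanish for k ≥ N. In characteristic zero the factors k!/(k-j)! are
-- invertible, so f_{kj} = 0 whenever j ≤ k and k ≥ N. On the other hand f_k(D) X^k x^n can
-- contribute to x^(n+t) only through f_{k,k-t}, which needs k ≥ t; so for t > N nothing
-- contributes and q_t = 0, with T = N.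
module Submission where

open import Defs
open import Data.Nat using (ℕ; _<_)
open import Data.Product using (∃-syntax)
open import Algebra.Bundles using (CommutativeRing)

import Data.Nat as ℕ
open import Data.Nat using (zero; suc; _≤_; _∸_; s≤s; _≤?_)
import Data.Nat.Properties as ℕₚ
open import Data.Product using (_,_; proj₁; proj₂)
open import Data.List using ([]; _∷_; length)
open import Data.Empty using (⊥-elim)
open import Relation.Nullary using (yes; no)
open import Relation.Binary.PropositionalEquality as ≡ using (_≡_; _≢_)
import Algebra.Definitions.RawMonoid as RawMonoidDefs
import Relation.Binary.Reasoning.Setoid as SetoidReasoning

module _ {c ℓ} (K : CommutativeRing c ℓ) where
  open CommutativeRing K
  open Poly K
  open RawMonoidDefs +-rawMonoid renaming (_×_ to _·ℕ_)
  open SetoidReasoning setoid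

  ∑ : ℕ → (ℕ → Carrier) → Carrier
  ∑ zero    g = 0#
  ∑ (suc N) g = ∑ N g + g N

  ∑-cong : ∀ N {g h} → (∀ k → g k ≈ h k) → ∑ N g ≈ ∑ N h
  ∑-cong zero    e = refl
  ∑-cong (suc N) e = +-cong (∑-cong N e) (e N)

  ∑-zero : ∀ N {g} → (∀ k → k < N → g k ≈ 0#) → ∑ N g ≈ 0#
  ∑-zero zero    e = refl
  ∑-zero (suc N) e = trans (+-cong (∑-zero N (λ k k<N → e k (ℕₚ.m≤n⇒m≤1+n k<N))) (e N ℕₚ.≤-refl)) (+-identityʳ 0#)

  ∑-single : ∀ N {g} j → j < N → (∀ k → k ≢ j → g k ≈ 0#) → ∑ N g ≈ g j
  ∑-single (suc N) j j<1+N e with j ℕₚ.≟ N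
  ... | yes ≡.refl = trans (+-cong (∑-zero N (λ k k<N → e k (ℕₚ.<⇒≢ k<N))) refl) (+-identityˡ _)
  ... | no j≢N     = trans (+-cong (∑-single N j (ℕₚ.≤∧≢⇒< (ℕₚ.≤-pred j<1+N) j≢N) e) (e N (λ N≡j → j≢N (≡.sym N≡j))))
                           (+-identityʳ _)

  coeff-+P : ∀ p q i → coeff (p +P q) i ≈ coeff p i + coeff q i
  coeff-+P []      q       i       = sym (+-identityˡ _)
  coeff-+P (a ∷ p) []      i       = sym (+-identityʳ _)
  coeff-+P (a ∷ p) (b ∷ q) zero    = refl
  coeff-+P (a ∷ p) (b ∷ q) (suc i) = coeff-+P p q i

  coeff-scale : ∀ a p i → coeff (scale a p) i ≈ a * coeff p i
  coeff-scale a []      i       = sym (zeroʳ a)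
  coeff-scale a (b ∷ p) zero    = refl
  coeff-scale a (b ∷ p) (suc i) = coeff-scale a p i

  coeff-sumP : ∀ N g i → coeff (sumP N g) i ≈ ∑ N (λ k → coeff (g k) i)
  coeff-sumP zero    g i = refl
  coeff-sumP (suc N) g i = trans (coeff-+P (sumP N g) (g N) i) (+-cong (coeff-sumP N g i) refl)

  -- D^j x^(i+j) = rising i j · x^i
  rising : ℕ → ℕ → Carrier
  rising i zero    = 1#
  rising i (suc j) = (suc i ·ℕ 1#) * rising (suc i) j

  coeff-derivAux : ∀ a p i → coeff (derivAux a p) i ≈ (suc (a ℕ.+ i) ·ℕ 1#) * coeff p i
  coeff-derivAux a []       i       = sym (zeroʳ _)
  coeff-derivAux a (b ∷ bs) zero    rewrite ℕₚ.+-identityʳ a = refl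
  coeff-derivAux a (b ∷ bs) (suc i) rewrite ℕₚ.+-suc a i = coeff-derivAux (suc a) bs i

  coeff-Dop : ∀ p i → coeff (Dop p) i ≈ (suc i ·ℕ 1#) * coeff p (suc i)
  coeff-Dop []      i = sym (zeroʳ _)
  coeff-Dop (b ∷ p) i = coeff-derivAux 0 p i

  coeff-Dpow : ∀ j p i → coeff (Dpow j p) i ≈ rising i j * coeff p (j ℕ.+ i)
  coeff-Dpow zero    p i = sym (*-identityˡ _)
  coeff-Dpow (suc j) p i = begin
    coeff (Dop (Dpow j p)) i                                   ≈⟨ coeff-Dop (Dpow j p) i ⟩
    (suc i ·ℕ 1#) * coeff (Dpow j p) (suc i)                   ≈⟨ *-congˡ (coeff-Dpow j p (suc i)) ⟩
    (suc i ·ℕ 1#) * (rising (suc i) j * coeff p (j ℕ.+ suc i)) ≈⟨ *-assoc _ _ _ ⟨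
    rising i (suc j) * coeff p (j ℕ.+ suc i)                   ≡⟨ ≡.cong (λ l → rising i (suc j) * coeff p l) (ℕₚ.+-suc j i) ⟩
    rising i (suc j) * coeff p (suc j ℕ.+ i)                   ∎

  coeff-applyD : ∀ g p i → coeff (applyD g p) i ≈ ∑ (length p) (λ j → g j * coeff (Dpow j p) i)
  coeff-applyD g p i =
    trans (coeff-sumP (length p) _ i) (∑-cong (length p) (λ j → coeff-scale (g j) (Dpow j p) i))

  length-monomial : ∀ m → length (monomial m) ≡ suc m
  length-monomial zero    = ≡.refl
  length-monomial (suc m) = ≡.cong suc (length-monomial m)

  coeff-monomial-≡ : ∀ m → coeff (monomial m) m ≡ 1#
  coeff-monomial-≡ zero    = ≡.refl
  coeff-monomial-≡ (suc m) = coeff-monomial-≡ m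

  coeff-monomial-≢ : ∀ m l → l ≢ m → coeff (monomial m) l ≡ 0#
  coeff-monomial-≢ zero    zero    l≢m = ⊥-elim (l≢m ≡.refl)
  coeff-monomial-≢ zero    (suc l) l≢m = ≡.refl
  coeff-monomial-≢ (suc m) zero    l≢m = ≡.refl
  coeff-monomial-≢ (suc m) (suc l) l≢m = coeff-monomial-≢ m l (λ l≡m → l≢m (≡.cong suc l≡m))

  Xpow-monomial : ∀ k n → Xpow k (monomial n) ≡ monomial (k ℕ.+ n)
  Xpow-monomial zero    n = ≡.refl
  Xpow-monomial (suc k) n = ≡.cong (0# ∷_) (Xpow-monomial k n)

  coeff-applyD-monomial : ∀ g m i →
    coeff (applyD g (monomial m)) i ≈ ∑ (suc m) (λ j → g j * (rising i j * coeff (monomial m) (j ℕ.+ i)))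
  coeff-applyD-monomial g m i = begin
    coeff (applyD g (monomial m)) i                              ≈⟨ coeff-applyD g (monomial m) i ⟩
    ∑ (length (monomial m)) (λ j → g j * coeff (Dpow j (monomial m)) i)
      ≡⟨ ≡.cong (λ L → ∑ L (λ j → g j * coeff (Dpow j (monomial m)) i)) (length-monomial m) ⟩
    ∑ (suc m) (λ j → g j * coeff (Dpow j (monomial m)) i)        ≈⟨ ∑-cong (suc m) (λ j → *-congˡ (coeff-Dpow j (monomial m) i)) ⟩
    ∑ (suc m) (λ j → g j * (rising i j * coeff (monomial m) (j ℕ.+ i))) ∎

  applyD-monomial-summand-≈0 : ∀ (g : PowerSeries) m i j → j ℕ.+ i ≢ m → g j * (rising i j * coeff (monomial m) (j ℕ.+ i)) ≈ 0#
  applyD-monomial-summand-≈0 g m i j ne = begin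
    g j * (rising i j * coeff (monomial m) (j ℕ.+ i)) ≡⟨ ≡.cong (λ a → g j * (rising i j * a)) (coeff-monomial-≢ m _ ne) ⟩
    g j * (rising i j * 0#)                           ≈⟨ *-congˡ (zeroʳ _) ⟩
    g j * 0#                                          ≈⟨ zeroʳ _ ⟩
    0#                                                ∎

  coeff-applyD-monomial-on : ∀ g m i j → j ℕ.+ i ≡ m → coeff (applyD g (monomial m)) i ≈ g j * rising i j
  coeff-applyD-monomial-on g m i j j+i≡m = begin
    coeff (applyD g (monomial m)) i                          ≈⟨ coeff-applyD-monomial g m i ⟩
    ∑ (suc m) (λ j' → g j' * (rising i j' * coeff (monomial m) (j' ℕ.+ i)))
      ≈⟨ ∑-single (suc m) j j<1+m (λ j' j'≢j → applyD-monomial-summand-≈0 g m i j' (λ e → j'≢j (ℕₚ.+-cancelʳ-≡ i j' j (≡.trans e (≡.sym j+i≡m))))) ⟩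
    g j * (rising i j * coeff (monomial m) (j ℕ.+ i))        ≡⟨ ≡.cong (λ l → g j * (rising i j * coeff (monomial m) l)) j+i≡m ⟩
    g j * (rising i j * coeff (monomial m) m)                ≡⟨ ≡.cong (λ a → g j * (rising i j * a)) (coeff-monomial-≡ m) ⟩
    g j * (rising i j * 1#)                                  ≈⟨ *-congˡ (*-identityʳ _) ⟩
    g j * rising i j                                         ∎
    where
    j<1+m : j < suc m
    j<1+m = s≤s (≡.subst (j ≤_) j+i≡m (ℕₚ.m≤m+n j i))

  coeff-applyD-monomial-above : ∀ g m i → m < i → coeff (applyD g (monomial m)) i ≈ 0#
  coeff-applyD-monomial-above g m i m<i =
    trans (coeff-applyD-monomial g m i)
          (∑-zero (suc m) (λ j _ → applyD-monomial-summand-≈0 g m i j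
             (λ j+i≡m → ℕₚ.<⇒≢ (ℕₚ.<-≤-trans m<i (ℕₚ.m≤n+m i j)) (≡.sym j+i≡m))))

  coeff-term-monomial : ∀ f k n i → coeff (term f k (monomial n)) i ≡ coeff (applyD (f k) (monomial (k ℕ.+ n))) i
  coeff-term-monomial f k n i = ≡.cong (λ p → coeff (applyD (f k) p) i) (Xpow-monomial k n)

  coeff-term-above-diagonal : ∀ f k n t → (∀ j → j ℕ.+ t ≡ k → f k j ≈ 0#) →
    coeff (term f k (monomial n)) (n ℕ.+ t) ≈ 0#
  coeff-term-above-diagonal f k n t f-vanishes rewrite coeff-term-monomial f k n (n ℕ.+ t) with t ≤? k
  ... | yes t≤k = begin
    coeff (applyD (f k) (monomial (k ℕ.+ n))) (n ℕ.+ t) ≈⟨ coeff-applyD-monomial-on (f k) (k ℕ.+ n) (n ℕ.+ t) j j+n+t≡k+n ⟩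
    f k j * rising (n ℕ.+ t) j                         ≈⟨ *-congʳ (f-vanishes j j+t≡k) ⟩
    0# * rising (n ℕ.+ t) j                            ≈⟨ zeroˡ _ ⟩
    0#                                                 ∎
    where
    j = k ∸ t
    j+t≡k : j ℕ.+ t ≡ k
    j+t≡k = ℕₚ.m∸n+n≡m t≤k
    j+n+t≡k+n : j ℕ.+ (n ℕ.+ t) ≡ k ℕ.+ n
    j+n+t≡k+n = ≡.trans (≡.cong (j ℕ.+_) (ℕₚ.+-comm n t))
                        (≡.trans (≡.sym (ℕₚ.+-assoc j t n)) (≡.cong (ℕ._+ n) j+t≡k))
  ... | no t≰k = coeff-applyD-monomial-above (f k) (k ℕ.+ n) (n ℕ.+ t)
                   (≡.subst (k ℕ.+ n <_) (ℕₚ.+-comm t n) (ℕₚ.+-monoˡ-< n (ℕₚ.≰⇒> t≰k)))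

  module _ (isField : IsField K) where

    *-cancelʳ-≈0 : ∀ {a r} → r ≉ 0# → a * r ≈ 0# → a ≈ 0#
    *-cancelʳ-≈0 {a} {r} r≉0 ar≈0 with proj₂ isField r r≉0
    ... | r⁻¹ , rr⁻¹≈1 = begin
      a              ≈⟨ *-identityʳ a ⟨
      a * 1#         ≈⟨ *-congˡ rr⁻¹≈1 ⟨
      a * (r * r⁻¹)  ≈⟨ *-assoc a r r⁻¹ ⟨
      (a * r) * r⁻¹  ≈⟨ *-congʳ ar≈0 ⟩
      0# * r⁻¹       ≈⟨ zeroˡ r⁻¹ ⟩
      0#             ∎

    *-preserves-≉0 : ∀ {a b} → a ≉ 0# → b ≉ 0# → a * b ≉ 0#
    *-preserves-≉0 {a} {b} a≉0 b≉0 ab≈0 = b≉0 (*-cancelʳ-≈0 a≉0 (trans (*-comm b a) ab≈0))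

    rising-≉0 : CharZero K → ∀ i j → rising i j ≉ 0#
    rising-≉0 charZero i zero    1≈0 = proj₁ isField (sym 1≈0)
    rising-≉0 charZero i (suc j)     = *-preserves-≉0 (charZero i) (rising-≉0 charZero (suc i) j)

    coeffs-vanish-beyond : CharZero K → ∀ f N → (∀ k → N ≤ k → term f k (monomial 0) ≈P zeroP) →
      ∀ k → N ≤ k → ∀ j → j ≤ k → f k j ≈ 0#
    coeffs-vanish-beyond charZero f N terms-vanish k N≤k j j≤k =
      *-cancelʳ-≈0 (rising-≉0 charZero i j) (begin
        f k j * rising i j                            ≈⟨ coeff-applyD-monomial-on (f k) (k ℕ.+ 0) i j j+i≡k+0 ⟨
        coeff (applyD (f k) (monomial (k ℕ.+ 0))) i   ≡⟨ coeff-term-monomial f k 0 i ⟨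
        coeff (term f k (monomial 0)) i               ≈⟨ terms-vanish k N≤k i ⟩
        0#                                            ∎)
      where
      i = k ∸ j
      j+i≡k+0 : j ℕ.+ i ≡ k ℕ.+ 0
      j+i≡k+0 = ≡.trans (ℕₚ.m+[n∸m]≡n j≤k) (≡.sym (ℕₚ.+-identityʳ k))

mainTheorem9 : ∀ {c ℓ} (K : CommutativeRing c ℓ) → IsField K → CharZero K →
    (f : ℕ → Poly.PowerSeries K) (Q : Poly.Pol K → Poly.Pol K) →
    Poly.IsLinear K Q → Poly.HasDXExpansion K f Q →
    ∃[ T ] (∀ t → T < t → ∀ n →
    CommutativeRing._≈_ K (Poly.qQ K Q t n) (CommutativeRing.0# K))
mainTheorem9 K isField charZero f Q _ (converges , expands) = N , qQ-vanishes
  where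
  open CommutativeRing K
  open Poly K

  N : ℕ
  N = proj₁ (converges (monomial 0))

  f-vanishes : ∀ k → N ≤ k → ∀ j → j ≤ k → f k j ≈ 0#
  f-vanishes = coeffs-vanish-beyond K isField charZero f N (proj₂ (converges (monomial 0)))

  f-vanishes-on-diagonal : ∀ t → N < t → ∀ k j → j ℕ.+ t ≡ k → f k j ≈ 0#
  f-vanishes-on-diagonal t N<t k j j+t≡k =
    f-vanishes k (ℕₚ.≤-trans (ℕₚ.<⇒≤ N<t) (≡.subst (t ≤_) j+t≡k (ℕₚ.m≤n+m t j)))
               j (≡.subst (j ≤_) j+t≡k (ℕₚ.m≤m+n j t))

  qQ-vanishes : ∀ t → N < t → ∀ n → qQ Q t n ≈ 0#
  qQ-vanishes t N<t n =
    trans (expands (monomial n) Nₙ (proj₂ (converges (monomial n))) (n ℕ.+ t))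
      (trans (coeff-sumP K Nₙ (λ k → term f k (monomial n)) (n ℕ.+ t))
        (∑-zero K Nₙ (λ k _ → coeff-term-above-diagonal K f k n t (f-vanishes-on-diagonal t N<t k))))
    where
    Nₙ : ℕ
    Nₙ = proj₁ (converges (monomial n))
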